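{- Let $M$ be a loopless matroid on a finite set $E$ with rank function $r$, and let $M'$ be the matroid on $E$ with rank function $r'(S) := \min \sum_{i=1}^k (2r(P_i)-1)$, the minimum over all partitions $\{P_1,\ldots,P_k\}$ of $S$. Then $M$ is a quotient of $M'$, i.e. every flat of $M$ is a flat of $M'$.
   Context: A partition of a finite set $S$ is a set of pairwise disjoint nonempty subsets of $S$ with union $S$. It is known that $r'$ is a matroid rank function. A flat of a matroid with rank function $\rho$ is a set $F$ with $\rho(F \cup \{e\}) > \rho(F)$ for all $e \notin F$. -}

module Defs where

open import Data.Nat using (ℕ; _+_; _*_; _∸_; _≤_; _<_)
open import Data.Fin using (Fin)
open import Data.Fin.Subset using (Subset; _⊆_; _∪_; _∩_; ∣_∣; ⁅_⁆; _∉_; ⋃; Nonempty; ⊥)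
open import Data.List using (List; map)
open import Data.Nat.ListAction using (sum)
open import Data.List.Relation.Unary.All using (All)
open import Data.List.Relation.Unary.AllPairs using (AllPairs)
open import Data.Product using (Σ; _×_)
open import Relation.Binary.PropositionalEquality using (_≡_)
open import Relation.Nullary using (¬_)

record IsMatroidRank {n : ℕ} (r : Subset n → ℕ) : Set where
  field
    bounded     : ∀ X → r X ≤ ∣ X ∣
    monotone    : ∀ {X Y} → X ⊆ Y → r X ≤ r Y
    submodular  : ∀ X Y → r (X ∪ Y) + r (X ∩ Y) ≤ r X + r Y

Loopless : {n : ℕ} → (Subset n → ℕ) → Set
Loopless {n} r = ∀ (e : Fin n) → ¬ (r ⁅ e ⁆ ≡ 0)

-- A partition of S: a list of pairwise disjoint nonempty subsets with union S.
-- (Being pairwise disjoint and nonempty, the list has no repetitions, so it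
-- represents a set of blocks.)
record IsPartition {n : ℕ} (S : Subset n) (Ps : List (Subset n)) : Set where
  field
    nonempty : All Nonempty Ps
    disjoint : AllPairs (λ A B → A ∩ B ≡ ⊥) Ps
    union    : ⋃ Ps ≡ S

cost : {n : ℕ} → (Subset n → ℕ) → List (Subset n) → ℕ
cost r Ps = sum (map (λ P → 2 * r P ∸ 1) Ps)

IsRank' : {n : ℕ} → (Subset n → ℕ) → Subset n → ℕ → Set
IsRank' {n} r S k =
  Σ (List (Subset n)) (λ Ps → IsPartition S Ps × cost r Ps ≡ k)
  × (∀ (Ps : List (Subset n)) → IsPartition S Ps → k ≤ cost r Ps)

IsFlat : {n : ℕ} → (Subset n → ℕ) → Subset n → Set
IsFlat {n} r F = ∀ (e : Fin n) → e ∉ F → r F < r (F ∪ ⁅ e ⁆)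

IsFlat' : {n : ℕ} → (Subset n → ℕ) → Subset n → Set
IsFlat' {n} r F = ∀ (e : Fin n) → e ∉ F →
  ∀ (k k' : ℕ) → IsRank' r F k → IsRank' r (F ∪ ⁅ e ⁆) k' → k < k'

{-# OPTIONS --safe #-}
module Submission where

-- Take an optimal partition of F ∪ {e} and delete e from its block P, discarding P
-- if it becomes empty. The result partitions F; no block cost grows, and P's cost drops
-- strictly because submodularity for P and F together with r F < r (F ∪ {e}) forces
-- r (P - e) < r P. Hence r'(F) < r'(F ∪ {e}).

open import Defs
open import Data.Bool using (_∨_)
open import Data.Nat using (ℕ; suc; _+_; _*_; _∸_; _≤_; _<_; s≤s)
open import Data.Nat.Properties
open import Data.Nat.ListAction using (sum)
open import Data.Fin using (Fin)
open import Data.Fin.Subset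
open import Data.Fin.Subset.Properties
open import Data.Vec using (_∷_; []; here; there)
open import Data.List using (List; _∷_; []; map; filter)
open import Data.List.Properties using (map-∘)
open import Data.List.Membership.Propositional using (find; lose) renaming (_∈_ to _∈ₗ_)
open import Data.List.Relation.Unary.Any using (Any; here; there)
open import Data.List.Relation.Unary.All.Properties using (all-filter)
import Data.List.Relation.Unary.AllPairs as AllPairs
import Data.List.Relation.Unary.AllPairs.Properties as AllPairs
open import Data.Product using (_,_)
open import Data.Sum using (inj₁; inj₂)
open import Function using (_∘_)
open import Relation.Binary.PropositionalEquality
open import Relation.Nullary using (Dec; yes; no; contradiction)

private
  variable
    n : ℕ
    A : Set

x∈p─q⇒x∉q : ∀ {p q : Subset n} {x} → x ∈ p ─ q → x ∉ q
x∈p─q⇒x∉q {p = _ ∷ p} {outside ∷ q} (there x∈p─q) (there x∈q) = x∈p─q⇒x∉q {p = p} x∈p─q x∈q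
x∈p─q⇒x∉q {p = _ ∷ p} {inside ∷ q} (there x∈p─q) (there x∈q) = x∈p─q⇒x∉q {p = p} x∈p─q x∈q

x∈p-y⇒x≢y : ∀ {p : Subset n} {x y} → x ∈ p - y → x ≢ y
x∈p-y⇒x≢y {y = y} x∈p-y refl = x∈p─q⇒x∉q x∈p-y (x∈⁅x⁆ y)

∪-─-distribʳ : (p q s : Subset n) → (p ∪ q) ─ s ≡ (p ─ s) ∪ (q ─ s)
∪-─-distribʳ []      []      []            = refl
∪-─-distribʳ (x ∷ p) (y ∷ q) (outside ∷ s) = cong ((x ∨ y) ∷_) (∪-─-distribʳ p q s)
∪-─-distribʳ (x ∷ p) (y ∷ q) (inside  ∷ s) = cong (outside ∷_) (∪-─-distribʳ p q s)

p─p≡⊥ : (p : Subset n) → p ─ p ≡ ⊥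
p─p≡⊥ []            = refl
p─p≡⊥ (outside ∷ p) = cong (outside ∷_) (p─p≡⊥ p)
p─p≡⊥ (inside  ∷ p) = cong (outside ∷_) (p─p≡⊥ p)

p⊆⊥⇒p≡⊥ : {p : Subset n} → p ⊆ ⊥ → p ≡ ⊥
p⊆⊥⇒p≡⊥ {p = p} p⊆⊥ = ⊆-antisym p⊆⊥ (⊆-min p)

x∉p⇒p-x≡p : {p : Subset n} {x : Fin n} → x ∉ p → p - x ≡ p
x∉p⇒p-x≡p {p = p} {x} x∉p =
  ⊆-antisym (p─q⊆p p ⁅ x ⁆) (λ y∈p → x∈p∧x≢y⇒x∈p-y y∈p λ { refl → x∉p y∈p })

x∉p⇒[p∪⁅x⁆]-x≡p : {p : Subset n} {x : Fin n} → x ∉ p → (p ∪ ⁅ x ⁆) - x ≡ p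
x∉p⇒[p∪⁅x⁆]-x≡p {p = p} {x} x∉p = begin
  (p ∪ ⁅ x ⁆) ─ ⁅ x ⁆        ≡⟨ ∪-─-distribʳ p ⁅ x ⁆ ⁅ x ⁆ ⟩
  (p - x) ∪ (⁅ x ⁆ ─ ⁅ x ⁆)  ≡⟨ cong₂ _∪_ (x∉p⇒p-x≡p x∉p) (p─p≡⊥ ⁅ x ⁆) ⟩
  p ∪ ⊥                      ≡⟨ ∪-identityʳ p ⟩
  p                          ∎
  where open ≡-Reasoning

disjoint-⊆ : {p p′ q q′ : Subset n} → p′ ⊆ p → q′ ⊆ q → p ∩ q ≡ ⊥ → p′ ∩ q′ ≡ ⊥
disjoint-⊆ {p′ = p′} {q′ = q′} p′⊆p q′⊆q p∩q≡⊥ = p⊆⊥⇒p≡⊥ λ x∈p′∩q′ →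
  let x∈p′ , x∈q′ = x∈p∩q⁻ p′ q′ x∈p′∩q′
  in subst (_ ∈_) p∩q≡⊥ (x∈p∩q⁺ (p′⊆p x∈p′ , q′⊆q x∈q′))

⋃-map-─ : (q : Subset n) (Ps : List (Subset n)) → ⋃ (map (_─ q) Ps) ≡ ⋃ Ps ─ q
⋃-map-─ q []       = sym (p⊆⊥⇒p≡⊥ (p─q⊆p ⊥ q))
⋃-map-─ q (P ∷ Ps) = trans (cong ((P ─ q) ∪_) (⋃-map-─ q Ps)) (sym (∪-─-distribʳ P (⋃ Ps) q))

⋃-filter-nonempty : (Ps : List (Subset n)) → ⋃ (filter nonempty? Ps) ≡ ⋃ Ps
⋃-filter-nonempty []       = refl
⋃-filter-nonempty (P ∷ Ps) with nonempty? P
... | yes _  = cong (P ∪_) (⋃-filter-nonempty Ps)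
... | no ¬ne = begin
  ⋃ (filter nonempty? Ps) ≡⟨ ⋃-filter-nonempty Ps ⟩
  ⋃ Ps                    ≡⟨ ∪-identityˡ (⋃ Ps) ⟨
  ⊥ ∪ ⋃ Ps                ≡⟨ cong (_∪ ⋃ Ps) (Empty-unique ¬ne) ⟨
  P ∪ ⋃ Ps                ∎
  where open ≡-Reasoning

x∈⋃⁻ : {x : Fin n} (Ps : List (Subset n)) → x ∈ ⋃ Ps → Any (x ∈_) Ps
x∈⋃⁻ []       x∈⊥    = contradiction x∈⊥ ∉⊥
x∈⋃⁻ (P ∷ Ps) x∈P∪Ps with x∈p∪q⁻ P (⋃ Ps) x∈P∪Ps
... | inj₁ x∈P   = here x∈P
... | inj₂ x∈⋃Ps = there (x∈⋃⁻ Ps x∈⋃Ps)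

∈⇒⊆⋃ : {P : Subset n} {Ps : List (Subset n)} → P ∈ₗ Ps → P ⊆ ⋃ Ps
∈⇒⊆⋃ {Ps = _ ∷ Ps} (here refl) = p⊆p∪q (⋃ Ps)
∈⇒⊆⋃ {Ps = Q ∷ _}  (there P∈Ps) = q⊆p∪q Q _ ∘ ∈⇒⊆⋃ P∈Ps

deleteFromBlocks : Fin n → List (Subset n) → List (Subset n)
deleteFromBlocks e Ps = filter nonempty? (map (_- e) Ps)

deleteFromBlocks-isPartition : {S : Subset n} {Ps : List (Subset n)} (e : Fin n) →
  IsPartition S Ps → IsPartition (S - e) (deleteFromBlocks e Ps)
deleteFromBlocks-isPartition {S = S} {Ps} e partition = record
  { nonempty = all-filter nonempty? (map (_- e) Ps)
  ; disjoint = AllPairs.filter⁺ nonempty? (AllPairs.map⁺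
      (AllPairs.map (disjoint-⊆ (p─q⊆p _ ⁅ e ⁆) (p─q⊆p _ ⁅ e ⁆)) disjoint))
  ; union = begin
      ⋃ (deleteFromBlocks e Ps)  ≡⟨ ⋃-filter-nonempty (map (_- e) Ps) ⟩
      ⋃ (map (_- e) Ps)          ≡⟨ ⋃-map-─ ⁅ e ⁆ Ps ⟩
      ⋃ Ps - e                   ≡⟨ cong (_- e) union ⟩
      S - e                      ∎
  }
  where
  open IsPartition partition
  open ≡-Reasoning

sum-map-≤ : {f g : A → ℕ} → (∀ x → f x ≤ g x) → (xs : List A) → sum (map f xs) ≤ sum (map g xs)
sum-map-≤ f≤g []       = ≤-refl
sum-map-≤ f≤g (x ∷ xs) = +-mono-≤ (f≤g x) (sum-map-≤ f≤g xs)

sum-map-< : {f g : A → ℕ} {xs : List A} → (∀ x → f x ≤ g x) →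
  Any (λ x → f x < g x) xs → sum (map f xs) < sum (map g xs)
sum-map-< {xs = _ ∷ xs} f≤g (here fx<gx)   = +-mono-<-≤ fx<gx (sum-map-≤ f≤g xs)
sum-map-< {xs = x ∷ _}  f≤g (there f<g) = +-mono-≤-< (f≤g x) (sum-map-< f≤g f<g)

sum-map-filter-≤ : {P : A → Set} (f : A → ℕ) (P? : ∀ x → Dec (P x)) (xs : List A) →
  sum (map f (filter P? xs)) ≤ sum (map f xs)
sum-map-filter-≤ f P? []       = ≤-refl
sum-map-filter-≤ f P? (x ∷ xs) with P? x
... | yes _ = +-monoʳ-≤ (f x) (sum-map-filter-≤ f P? xs)
... | no _  = ≤-trans (sum-map-filter-≤ f P? xs) (m≤n+m _ (f x))

m≤n⇒2m∸1≤2n∸1 : {m n : ℕ} → m ≤ n → 2 * m ∸ 1 ≤ 2 * n ∸ 1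
m≤n⇒2m∸1≤2n∸1 m≤n = ∸-monoˡ-≤ 1 (*-monoʳ-≤ 2 m≤n)

m<n⇒2m∸1<2n∸1 : {m n : ℕ} → m < n → 2 * m ∸ 1 < 2 * n ∸ 1
m<n⇒2m∸1<2n∸1 {m} {suc n} (s≤s m≤n) = begin-strict
  2 * m ∸ 1      ≤⟨ m∸n≤m (2 * m) 1 ⟩
  2 * m          <⟨ s≤s (*-monoʳ-≤ 2 m≤n) ⟩
  suc (2 * n)    ≡⟨ cong (_∸ 1) (*-distribˡ-+ 2 1 n) ⟨
  2 * suc n ∸ 1  ∎
  where open ≤-Reasoning

module _ {r : Subset n → ℕ} (rank : IsMatroidRank r) {F : Subset n} {e : Fin n}
         (e-augments : r F < r (F ∪ ⁅ e ⁆)) where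
  open IsMatroidRank rank

  rank-delete< : {P : Subset n} → e ∈ P → P ⊆ F ∪ ⁅ e ⁆ → r (P - e) < r P
  rank-delete< {P} e∈P P⊆F+e = +-cancelˡ-≤ (r F) (suc (r (P - e))) (r P) (begin
    r F + suc (r (P - e))       ≡⟨ +-suc (r F) _ ⟩
    suc (r F) + r (P - e)       ≤⟨ +-monoˡ-≤ _ e-augments ⟩
    r (F ∪ ⁅ e ⁆) + r (P - e)   ≤⟨ +-mono-≤ (monotone F+e⊆P∪F) (monotone P-e⊆P∩F) ⟩
    r (P ∪ F) + r (P ∩ F)       ≤⟨ submodular P F ⟩
    r P + r F                   ≡⟨ +-comm (r P) (r F) ⟩
    r F + r P                   ∎)
    where
    open ≤-Reasoning
    F+e⊆P∪F : F ∪ ⁅ e ⁆ ⊆ P ∪ F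
    F+e⊆P∪F x∈F+e with x∈p∪q⁻ F ⁅ e ⁆ x∈F+e
    ... | inj₁ x∈F = q⊆p∪q P F x∈F
    ... | inj₂ x∈e = p⊆p∪q F (subst (_∈ P) (sym (x∈⁅y⁆⇒x≡y e x∈e)) e∈P)
    P-e⊆P∩F : P - e ⊆ P ∩ F
    P-e⊆P∩F x∈P-e with x∈p∪q⁻ F ⁅ e ⁆ (P⊆F+e (p─q⊆p P ⁅ e ⁆ x∈P-e))
    ... | inj₁ x∈F = x∈p∩q⁺ (p─q⊆p P ⁅ e ⁆ x∈P-e , x∈F)
    ... | inj₂ x∈e = contradiction (x∈⁅y⁆⇒x≡y e x∈e) (x∈p-y⇒x≢y x∈P-e)

  cost-deleteFromBlocks< : {Ps : List (Subset n)} → IsPartition (F ∪ ⁅ e ⁆) Ps →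
    cost r (deleteFromBlocks e Ps) < cost r Ps
  cost-deleteFromBlocks< {Ps} partition = begin-strict
    cost r (deleteFromBlocks e Ps)           ≤⟨ sum-map-filter-≤ blockCost nonempty? (map (_- e) Ps) ⟩
    cost r (map (_- e) Ps)                   ≡⟨ cong sum (map-∘ Ps) ⟨
    sum (map (blockCost ∘ (_- e)) Ps)        <⟨ sum-map-< (λ P → m≤n⇒2m∸1≤2n∸1 (monotone (p─q⊆p P ⁅ e ⁆))) cost-drops ⟩
    cost r Ps                                ∎
    where
    open IsPartition partition
    open ≤-Reasoning
    blockCost : Subset n → ℕ
    blockCost P = 2 * r P ∸ 1
    cost-drops : Any (λ P → blockCost (P - e) < blockCost P) Ps
    cost-drops with find (x∈⋃⁻ Ps (subst (e ∈_) (sym union) (q⊆p∪q F ⁅ e ⁆ (x∈⁅x⁆ e))))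
    ... | P , P∈Ps , e∈P =
      lose P∈Ps (m<n⇒2m∸1<2n∸1 (rank-delete< e∈P (subst (P ⊆_) union (∈⇒⊆⋃ P∈Ps))))

lemma3p2 : (n : ℕ) (r : Subset n → ℕ) → IsMatroidRank r → Loopless r →
    ∀ (F : Subset n) → IsFlat r F → IsFlat' r F
lemma3p2 n r rank _ F flat e e∉F k k' (_ , minimal) ((Ps , partition , refl) , _) = begin-strict
  k                               ≤⟨ minimal (deleteFromBlocks e Ps) partitionF ⟩
  cost r (deleteFromBlocks e Ps)  <⟨ cost-deleteFromBlocks< rank (flat e e∉F) partition ⟩
  cost r Ps                       ∎
  where
  open ≤-Reasoning
  partitionF : IsPartition F (deleteFromBlocks e Ps)
  partitionF = subst (λ S → IsPartition S (deleteFromBlocks e Ps))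
    (x∉p⇒[p∪⁅x⁆]-x≡p e∉F) (deleteFromBlocks-isPartition e partition)
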